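{- Let $G=(V,E)$ be a DAG, let $\psi$ be an $r^{(top)}$-sequence of $G$, and let $u,v$ be distinct vertices of $B_{r^{(top)}}(\psi)$. Then $\mathrm{reach}_{r^{(top)}}(u\mid\psi u)\cap\mathrm{reach}_{r^{(top)}}(v\mid\psi v)=\emptyset$.
   Context: For a vertex $v$ of a finite DAG $G=(V,E)$, $\mathrm{pred}(v)=\{u : (u,v)\in E\}$ and $\mathrm{des}(v)$ is the set of vertices reachable from $v$ by a directed path. The topological rule assigns to each $v$ the single enabler $\mathrm{pred}(v)$, i.e. $r^{(top)}(v)=\{\mathrm{pred}(v)\}$. An $r^{(top)}$-sequence is a sequence $\psi$ of distinct vertices such that every vertex of $\psi$ is preceded in $\psi$ by all its predecessors. The boundary is $B_{r^{(top)}}(\psi)=\{w\in V\setminus\psi : \mathrm{pred}(w)\neq\emptyset,\ \mathrm{pred}(w)\subseteq\psi\}$. For an $r^{(top)}$-sequence $\psi$ and a vertex $v\in\psi$, $\mathrm{reach}_{r^{(top)}}(v\mid\psi)=\{w : \exists$ a sequence $\psi'$ such that all vertices of $\psi'w$ lie in $\mathrm{des}(v)$ and $\psi\psi'w$ is an $r^{(top)}$-sequence$\}$. (For $u\in B_{r^{(top)}}(\psi)$, $\psi u$ is an $r^{(top)}$-sequence.) -}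

module Defs where

open import Data.Nat using (ℕ)
open import Data.Fin using (Fin)
open import Data.Bool using (Bool; true)
open import Data.List using (List; []; _∷ʳ_; _++_)
open import Data.List.Membership.Propositional using (_∈_; _∉_)
open import Data.List.Relation.Unary.All using (All)
open import Data.Product using (Σ; ∃; _×_)
open import Relation.Binary.PropositionalEquality using (_≡_)
open import Relation.Nullary using (¬_)
open import Relation.Binary.Construct.Closure.Transitive using (TransClosure)
open import Relation.Binary.Construct.Closure.ReflexiveTransitive using (Star)

record Digraph : Set where
  field
    n    : ℕ
    edge : Fin n → Fin n → Bool

module _ (G : Digraph) where
  open Digraph G

  V : Set
  V = Fin n

  E : V → V → Set
  E x y = edge x y ≡ true

  IsDAG : Set
  IsDAG = ∀ v → ¬ TransClosure E v v

  Des : V → V → Set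
  Des v w = Star E v w

  data TopSeq : List V → Set where
    []   : TopSeq []
    snoc : ∀ {ψ x} → TopSeq ψ → x ∉ ψ → (∀ y → E y x → y ∈ ψ) → TopSeq (ψ ∷ʳ x)

  Boundary : List V → V → Set
  Boundary ψ w = w ∉ ψ × (∃ λ y → E y w) × (∀ y → E y w → y ∈ ψ)

  Reach : V → List V → V → Set
  Reach v ψ w = Σ (List V) λ ψ' → All (Des v) (ψ' ∷ʳ w) × TopSeq (ψ ++ (ψ' ∷ʳ w))

{-# OPTIONS --safe #-}
module Submission where

-- Suppose w is reachable from both u and v. Every r^(top)-sequence is closed
-- under ancestors, so the sequence witnessing w ∈ reach(u | ψu) contains the
-- ancestor v of w; as v ∉ ψu, v lies in its part inside des(u), so u reaches v.
-- But a vertex outside the ancestor-closed set ψ can reach the boundary vertex v,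
-- all of whose predecessors lie in ψ, only by being v itself; and u ≢ v.

open import Defs
open import Data.List using (List; _∷ʳ_; _++_)
open import Data.Product using (_×_; _,_; proj₂)
open import Data.Sum using (_⊎_; inj₁; inj₂)
open import Data.Empty using (⊥-elim)
open import Relation.Binary.PropositionalEquality using (_≡_; _≢_; refl; ≢-sym)
open import Relation.Nullary using (¬_)
open import Data.List.Membership.Propositional using (_∈_; _∉_)
open import Data.List.Membership.Propositional.Properties using (∈-++⁻; ∈-++⁺ˡ; ∈-++⁺ʳ)
open import Data.List.Relation.Unary.Any using (here)
open import Data.List.Relation.Unary.All using (lookup)
open import Data.List.Relation.Unary.All.Properties using (∷ʳ⁻)
open import Relation.Binary.Construct.Closure.ReflexiveTransitive using (ε; _◅_)

∈-∷ʳ⁻ : ∀ {a} {A : Set a} {x y : A} xs → x ∈ xs ∷ʳ y → x ∈ xs ⊎ x ≡ y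
∈-∷ʳ⁻ xs x∈ with ∈-++⁻ xs x∈
... | inj₁ x∈xs      = inj₁ x∈xs
... | inj₂ (here eq) = inj₂ eq

∉-∷ʳ : ∀ {a} {A : Set a} {x y : A} {xs} → x ∉ xs → x ≢ y → x ∉ xs ∷ʳ y
∉-∷ʳ {xs = xs} x∉xs x≢y x∈ with ∈-∷ʳ⁻ xs x∈
... | inj₁ x∈xs = x∉xs x∈xs
... | inj₂ x≡y  = x≢y x≡y

module _ {G : Digraph} where

  TopSeq-pred-closed : ∀ {ψ a x} → TopSeq G ψ → x ∈ ψ → E G a x → a ∈ ψ
  TopSeq-pred-closed (snoc {ψ} t _ preds) x∈ e with ∈-∷ʳ⁻ ψ x∈
  ... | inj₁ x∈ψ  = ∈-++⁺ˡ (TopSeq-pred-closed t x∈ψ e)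
  ... | inj₂ refl = ∈-++⁺ˡ (preds _ e)

  TopSeq-ancestor-closed : ∀ {ψ a x} → TopSeq G ψ → x ∈ ψ → Des G a x → a ∈ ψ
  TopSeq-ancestor-closed t x∈ ε       = x∈
  TopSeq-ancestor-closed t x∈ (e ◅ s) =
    TopSeq-pred-closed t (TopSeq-ancestor-closed t x∈ s) e

  Reach⇒Des : ∀ {v ψ w} → Reach G v ψ w → Des G v w
  Reach⇒Des (_ , des , _) = proj₂ (∷ʳ⁻ des)

  Des-of-ancestor-of-Reach : ∀ {v ψ w x} →
    Reach G v ψ w → Des G x w → x ∉ ψ → Des G v x
  Des-of-ancestor-of-Reach {ψ = ψ} (ψ' , des , t) x→w x∉ψ
    with ∈-++⁻ ψ (TopSeq-ancestor-closed t (∈-++⁺ʳ ψ (∈-++⁺ʳ ψ' (here refl))) x→w)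
  ... | inj₁ x∈ψ  = ⊥-elim (x∉ψ x∈ψ)
  ... | inj₂ x∈ψ' = lookup des x∈ψ'

  -- Induction along the path: its second vertex is again outside ψ, since ψ is
  -- closed under predecessors.
  Des-outside-to-Boundary⇒≡ : ∀ {ψ u v} → TopSeq G ψ → u ∉ ψ →
    (∀ y → E G y v → y ∈ ψ) → Des G u v → u ≡ v
  Des-outside-to-Boundary⇒≡ t u∉ψ preds ε = refl
  Des-outside-to-Boundary⇒≡ t u∉ψ preds (e ◅ s)
    with Des-outside-to-Boundary⇒≡ t (λ x∈ψ → u∉ψ (TopSeq-pred-closed t x∈ψ e)) preds s
  ... | refl = ⊥-elim (u∉ψ (preds _ e))

lemma15 : (G : Digraph) → IsDAG G → (ψ : List (V G)) → TopSeq G ψ →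
          (u v : V G) → Boundary G ψ u → Boundary G ψ v → u ≢ v →
          ∀ w → ¬ (Reach G u (ψ ∷ʳ u) w × Reach G v (ψ ∷ʳ v) w)
lemma15 G _ ψ tψ u v (u∉ψ , _ , _) (v∉ψ , _ , preds-v) u≢v w (reach-u , reach-v) =
  u≢v (Des-outside-to-Boundary⇒≡ tψ u∉ψ preds-v u→v)
  where
    u→v : Des G u v
    u→v = Des-of-ancestor-of-Reach reach-u (Reach⇒Des {ψ = ψ ∷ʳ v} reach-v)
                                   (∉-∷ʳ v∉ψ (≢-sym u≢v))
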